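{- Let $x\in\mathrm{Tam}(B_n)$. Then the value $2n$ occurs in $\mathsf{Pop}_{\mathrm{Tam}(B_n)}(x)$ at a position at least $n+1$.
   Context: $B_n$ is the set of permutations $x=x_1\cdots x_{2n}$ of $\{1,\dots,2n\}$ with $x_i+x_{2n+1-i}=2n+1$ for all $i$, ordered by the right weak order ($x\le y$ iff every pair of values $a<b$ with $b$ before $a$ in $x$ also has $b$ before $a$ in $y$). $x\in B_n$ contains a $312^*$ pattern if there are $i<j<k$ with $x_j<x_k<x_i$ and $x_k\ge n+1$. $\mathrm{Tam}(B_n)$ is the lattice of $312^*$-avoiding elements of $B_n$ with the induced order. For a finite lattice $M$, $\mathsf{Pop}_M(x)$ is the meet (in $M$) of $x$ together with all elements of $M$ covered by $x$. -}

module Defs where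

open import Data.Nat using (ℕ; suc; _+_; _≤_; _<_)
open import Data.Fin using (Fin; toℕ; opposite) renaming (_<_ to _<ᶠ_)
open import Data.Product using (Σ; _×_; ∃; ∃-syntax)
open import Relation.Binary.PropositionalEquality using (_≡_)
open import Relation.Nullary using (¬_)
open import Data.Sum using (_⊎_)

-- A word of length 2n with letters in ℕ; position i (0-based, Fin (n + n))
-- corresponds to the paper's position toℕ i + 1.
Word : ℕ → Set
Word n = Fin (n + n) → ℕ

-- x is a permutation of {1,…,2n}: injective with all values in {1,…,2n}
-- (injective from a 2n-set into a 2n-set, hence bijective).
IsPerm : (n : ℕ) → Word n → Set
IsPerm n x = (∀ i → 1 ≤ x i × x i ≤ n + n)
           × (∀ i j → x i ≡ x j → i ≡ j)

IsSigned : (n : ℕ) → Word n → Set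
IsSigned n x = ∀ i → x i + x (opposite i) ≡ suc (n + n)

InB : (n : ℕ) → Word n → Set
InB n x = IsPerm n x × IsSigned n x

Before : (n : ℕ) → ℕ → ℕ → Word n → Set
Before n b a x = ∃[ i ] ∃[ j ] (i <ᶠ j × x i ≡ b × x j ≡ a)

WeakLe : (n : ℕ) → Word n → Word n → Set
WeakLe n x y = ∀ a b → a < b → Before n b a x → Before n b a y

Has312* : (n : ℕ) → Word n → Set
Has312* n x = ∃[ i ] ∃[ j ] ∃[ k ]
  (i <ᶠ j × j <ᶠ k × x j < x k × x k < x i × suc n ≤ x k)

InTam : (n : ℕ) → Word n → Set
InTam n x = InB n x × ¬ Has312* n x

WordEq : (n : ℕ) → Word n → Word n → Set
WordEq n x y = ∀ i → x i ≡ y i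

CoveredInTam : (n : ℕ) → Word n → Word n → Set
CoveredInTam n y x =
  InTam n y × WeakLe n y x × ¬ (WordEq n y x)
  × (∀ z → InTam n z → WeakLe n y z → WeakLe n z x → WordEq n z y ⊎ WordEq n z x)

-- m is the meet in Tam(B_n) of x together with all elements of Tam(B_n)
-- covered by x, i.e. m = Pop_{Tam(B_n)}(x).
IsPopTam : (n : ℕ) → Word n → Word n → Set
IsPopTam n x m =
  InTam n m × WeakLe n m x × (∀ y → CoveredInTam n y x → WeakLe n m y)
  × (∀ z → InTam n z → WeakLe n z x → (∀ y → CoveredInTam n y x → WeakLe n z y) → WeakLe n z m)

{-# OPTIONS --safe #-}
module Submission where

-- In a signed permutation 2n and 1 occupy mirror positions, so it suffices that 1 precedes 2n in
-- Pop(x), which lies below x and below every lower cover of x.  If 1 precedes 2n in x this is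
-- inherited.  Otherwise the whole first half of x is large (> n), and exchanging a suitable final segment
-- [q, n) of the first half with its mirror block [n, 2n - q) gives a lower cover of x in Tam(B_n) in
-- which 1 precedes 2n; q is the largest cut up to the position of 2n below which every entry is
-- smaller than the rest of the first half.
-- The meet exists because in a 312*-avoiding signed permutation an inversion c ... a with a < b < c
-- passes through b (b before a if b > n, c before b if b <= n), so the common inversions of finitely
-- many elements of Tam(B_n) again form the inversion set of an element of Tam(B_n).

open import Defs
open import Data.Nat as ℕ using (ℕ; zero; suc; _+_; _∸_; _≤_; _<_; z≤n; s≤s; _≟_; _<?_; _≤?_)
open import Data.Nat.Properties
open import Data.Fin as F using (Fin; toℕ; fromℕ<; opposite; punchOut)
import Data.Fin.Properties as FP
import Data.Fin.Induction as FI
open import Data.Product using (Σ; ∃; ∃-syntax; _×_; _,_; proj₁; proj₂)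
open import Data.Sum as Sum using (_⊎_; inj₁; inj₂; [_,_]′)
open import Data.Empty using (⊥-elim)
open import Data.Bool using (Bool; true; false; if_then_else_)
open import Function using (_∘_; case_of_)
open import Data.List as List using (List; []; _∷_; concatMap; allFin; filter)
open import Data.List.Relation.Unary.Any as Any using (here; there)
open import Data.List.Membership.Propositional.Properties
  using (∈-concatMap⁺; ∈-map⁺; ∈-map⁻; ∈-allFin; ∈-filter⁺; ∈-filter⁻)
open import Data.Vec as Vec using (Vec; []; _∷_)
import Data.Vec.Properties as VP
open import Data.List.Membership.Propositional using (_∈_)
open import Data.List.Relation.Unary.All as All using (All; _∷_)
open import Induction.WellFounded using (Acc; acc)
open import Relation.Nullary
open import Relation.Nullary.Decidable using (dec-true; dec-false; _×-dec_; _⊎-dec_; _→-dec_; ¬?)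
open import Relation.Binary.PropositionalEquality
open import Relation.Binary.Definitions using (tri<; tri≈; tri>)

bounded-injection-surjective : ∀ {k} (f : Fin k → ℕ) → (∀ i → f i < k) →
  (∀ {i j} → f i ≡ f j → i ≡ j) → ∀ {v} → v < k → ∃ λ i → f i ≡ v
bounded-injection-surjective f f<k f-inj {v} v<k with FP.any? (λ i → f i ≟ v)
... | yes hit = hit
bounded-injection-surjective {suc k} f f<k f-inj {v} v<k | no miss =
  contradiction (FP.injective⇒≤ g-injective) 1+n≰n
  where
  v≢f : ∀ i → fromℕ< v<k ≢ fromℕ< (f<k i)
  v≢f i eq = miss (i , sym (FP.fromℕ<-injective _ _ v<k (f<k i) eq))
  g : Fin (suc k) → Fin k
  g i = punchOut (v≢f i)
  g-injective : ∀ {i j} → g i ≡ g j → i ≡ j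
  g-injective {i} {j} eq =
    f-inj (FP.fromℕ<-injective _ _ (f<k i) (f<k j) (FP.punchOut-injective (v≢f i) (v≢f j) eq))

count : ∀ {k} → (Fin k → Bool) → ℕ
count {zero}  p = 0
count {suc k} p = (if p F.zero then 1 else 0) + count (p ∘ F.suc)

count≤ : ∀ {k} (p : Fin k → Bool) → count p ≤ k
count≤ {zero}  p = z≤n
count≤ {suc k} p with p F.zero
... | true  = s≤s (count≤ (p ∘ F.suc))
... | false = m≤n⇒m≤1+n (count≤ (p ∘ F.suc))

count<-if-false : ∀ {k} (p : Fin k → Bool) i → p i ≡ false → count p < k
count<-if-false {suc k} p F.zero    pi≡false rewrite pi≡false = s≤s (count≤ (p ∘ F.suc))
count<-if-false {suc k} p (F.suc i) pi≡false with p F.zero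
... | true  = s≤s (count<-if-false (p ∘ F.suc) i pi≡false)
... | false = m≤n⇒m≤1+n (count<-if-false (p ∘ F.suc) i pi≡false)

count-mono : ∀ {k} (p q : Fin k → Bool) → (∀ i → p i ≡ true → q i ≡ true) → count p ≤ count q
count-mono {zero}  p q p⇒q = z≤n
count-mono {suc k} p q p⇒q with p F.zero in p₀ | q F.zero in q₀
... | true  | true  = s≤s (count-mono _ _ (p⇒q ∘ F.suc))
... | true  | false with () ← trans (sym (p⇒q F.zero p₀)) q₀
... | false | true  = m≤n⇒m≤1+n (count-mono _ _ (p⇒q ∘ F.suc))
... | false | false = count-mono _ _ (p⇒q ∘ F.suc)

count-strict : ∀ {k} (p q : Fin k → Bool) → (∀ i → p i ≡ true → q i ≡ true) →
  ∀ i → q i ≡ true → p i ≡ false → count p < count q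
count-strict {suc k} p q p⇒q F.zero qi pi rewrite qi | pi = s≤s (count-mono _ _ (p⇒q ∘ F.suc))
count-strict {suc k} p q p⇒q (F.suc i) qi pi with p F.zero in p₀ | q F.zero in q₀
... | true  | true  = s≤s (count-strict _ _ (p⇒q ∘ F.suc) i qi pi)
... | true  | false with () ← trans (sym (p⇒q F.zero p₀)) q₀
... | false | true  = s≤s (count-mono _ _ (p⇒q ∘ F.suc))
... | false | false = count-strict _ _ (p⇒q ∘ F.suc) i qi pi

module Permutations (n : ℕ) where

  N : ℕ
  N = n + n

  InRange : ℕ → Set
  InRange v = 1 ≤ v × v ≤ N

  pred<N : ∀ {v} → InRange v → ℕ.pred v < N
  pred<N (s≤s _ , v≤N) = v≤N

  suc-pred-inRange : ∀ {v} → InRange v → suc (ℕ.pred v) ≡ v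
  suc-pred-inRange (s≤s _ , _) = refl

  pred-cancel-inRange : ∀ {u v} → InRange u → InRange v → ℕ.pred u ≡ ℕ.pred v → u ≡ v
  pred-cancel-inRange (s≤s _ , _) (s≤s _ , _) = cong suc

  perm-surjective : ∀ {x : Word n} → IsPerm n x → ∀ {v} → InRange v → ∃ λ i → x i ≡ v
  perm-surjective {x} (x-range , x-inj) {v} v-range
    with i , eq ← bounded-injection-surjective (ℕ.pred ∘ x) (pred<N ∘ x-range)
                    (λ eq → x-inj _ _ (pred-cancel-inRange (x-range _) (x-range _) eq)) (pred<N v-range)
    = i , pred-cancel-inRange (x-range i) v-range eq

  before? : ∀ b a (x : Word n) → Dec (Before n b a x)
  before? b a x = FP.any? λ i → FP.any? λ j → (i FP.<? j) ×-dec (x i ≟ b) ×-dec (x j ≟ a)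

  before-inRange : ∀ {x : Word n} {a b} → IsPerm n x → Before n b a x → InRange b × InRange a
  before-inRange (x-range , _) (i , j , _ , refl , refl) = x-range i , x-range j

  before-trans : ∀ {x : Word n} {a b c} → IsPerm n x → Before n c b x → Before n b a x → Before n c a x
  before-trans (_ , x-inj) (i , j , i<j , xi , xj) (j′ , k , j′<k , xj′ , xk)
    with refl ← x-inj j j′ (trans xj (sym xj′)) = i , k , <-trans i<j j′<k , xi , xk

  before-irrefl : ∀ {x : Word n} {a} → IsPerm n x → ¬ Before n a a x
  before-irrefl (_ , x-inj) (i , j , i<j , xi , xj)
    with refl ← x-inj i j (trans xi (sym xj)) = <-irrefl refl i<j

  before-asym : ∀ {x : Word n} {a b} → IsPerm n x → Before n b a x → ¬ Before n a b x
  before-asym x-perm ba ab = before-irrefl x-perm (before-trans x-perm ba ab)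

  before-total : ∀ {x : Word n} {a b} → IsPerm n x → InRange a → InRange b → a ≢ b →
                 Before n a b x ⊎ Before n b a x
  before-total x-perm a-range b-range a≢b
    with i , xi ← perm-surjective x-perm a-range | j , xj ← perm-surjective x-perm b-range
    with FP.<-cmp i j
  ... | tri< i<j _ _ = inj₁ (i , j , i<j , xi , xj)
  ... | tri≈ _ refl _ = ⊥-elim (a≢b (trans (sym xi) xj))
  ... | tri> _ _ j<i = inj₂ (j , i , j<i , xj , xi)

  weakLe-antisym-before : ∀ {x y : Word n} → IsPerm n x → IsPerm n y → WeakLe n x y → WeakLe n y x →
                      ∀ {a b} → Before n b a x → Before n b a y
  weakLe-antisym-before x-perm y-perm x≤y y≤x {a} {b} ba with <-cmp a b
  ... | tri< a<b _ _ = x≤y a b a<b ba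
  ... | tri≈ _ refl _ = ⊥-elim (before-irrefl x-perm ba)
  ... | tri> _ _ b<a with before-inRange x-perm ba
  ...   | b-range , a-range with before-total y-perm b-range a-range (<⇒≢ b<a)
  ...     | inj₁ ba′ = ba′
  ...     | inj₂ ab = ⊥-elim (before-asym x-perm ba (y≤x b a b<a ab))

  weakLe-antisym : ∀ {x y : Word n} → IsPerm n x → IsPerm n y → WeakLe n x y → WeakLe n y x → WordEq n x y
  weakLe-antisym {x} {y} x-perm@(_ , x-inj) y-perm@(_ , y-inj) x≤y y≤x i = go i (FI.<-wellFounded i)
    where
    go : ∀ i → Acc F._<_ i → x i ≡ y i
    go i (acc earlier) with j , yj ← perm-surjective y-perm (proj₁ x-perm i) with FP.<-cmp j i
    ... | tri< j<i _ _ = ⊥-elim (FP.<-irrefl (x-inj j i (trans (go j (earlier j<i)) yj)) j<i)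
    ... | tri≈ _ refl _ = sym yj
    ... | tri> _ _ i<j with l , xl ← perm-surjective x-perm (proj₁ y-perm i) with FP.<-cmp l i
    ...   | tri< l<i _ _ = ⊥-elim (FP.<-irrefl (y-inj l i (trans (sym (go l (earlier l<i))) xl)) l<i)
    ...   | tri≈ _ refl _ = xl
    ...   | tri> _ _ i<l = ⊥-elim (before-asym y-perm
              (weakLe-antisym-before x-perm y-perm x≤y y≤x (i , l , i<l , refl , xl)) (i , j , i<j , refl , yj))

  wordEq-sym : ∀ {z z′ : Word n} → WordEq n z z′ → WordEq n z′ z
  wordEq-sym z≡z′ i = sym (z≡z′ i)

  wordEq-trans : ∀ {z z′ z″ : Word n} → WordEq n z z′ → WordEq n z′ z″ → WordEq n z z″
  wordEq-trans z≡z′ z′≡z″ i = trans (z≡z′ i) (z′≡z″ i)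

  before-resp : ∀ {z z′ : Word n} {a b} → WordEq n z z′ → Before n b a z → Before n b a z′
  before-resp z≡z′ (i , j , i<j , zi , zj) = i , j , i<j , trans (sym (z≡z′ i)) zi , trans (sym (z≡z′ j)) zj

  weakLe-respˡ : ∀ {z z′ y : Word n} → WordEq n z z′ → WeakLe n z y → WeakLe n z′ y
  weakLe-respˡ z≡z′ z≤y a b a<b ba = z≤y a b a<b (before-resp (wordEq-sym z≡z′) ba)

  weakLe-respʳ : ∀ {z y y′ : Word n} → WordEq n y y′ → WeakLe n z y → WeakLe n z y′
  weakLe-respʳ y≡y′ z≤y a b a<b ba = before-resp y≡y′ (z≤y a b a<b ba)

  mirror : ℕ → ℕ
  mirror v = suc N ∸ v

  mirror-involutive : ∀ {v} → v ≤ suc N → mirror (mirror v) ≡ v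
  mirror-involutive = m∸[m∸n]≡n

  mirror-involutive-inRange : ∀ {v} → InRange v → mirror (mirror v) ≡ v
  mirror-involutive-inRange (_ , v≤N) = mirror-involutive (m≤n⇒m≤1+n v≤N)

  mirror-inRange : ∀ {v} → InRange v → InRange (mirror v)
  mirror-inRange (1≤v , v≤N) = m<n⇒0<n∸m (s≤s v≤N) , ∸-monoʳ-≤ (suc N) 1≤v

  mirror-reverse : ∀ {a b} → a < b → b ≤ suc N → mirror b < mirror a
  mirror-reverse = ∸-monoʳ-<

  mirror-large : ∀ {v} → v ≤ n → suc n ≤ mirror v
  mirror-large {v} v≤n = subst (_≤ mirror v) (m+n∸n≡m (suc n) n) (∸-monoʳ-≤ (suc N) v≤n)

  mirror-small : ∀ {v} → suc n ≤ v → mirror v ≤ n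
  mirror-small {v} n<v = subst (mirror v ≤_) (m+n∸n≡m n n) (∸-monoʳ-≤ (suc N) n<v)

  signed-opposite : ∀ {x : Word n} → IsSigned n x → ∀ i → x (opposite i) ≡ mirror (x i)
  signed-opposite {x} x-signed i = trans (sym (m+n∸m≡n (x i) (x (opposite i)))) (cong (_∸ x i) (x-signed i))

  opposite-reverse : ∀ {i j : Fin N} → i F.< j → opposite j F.< opposite i
  opposite-reverse {i} {j} i<j rewrite FP.opposite-prop j | FP.opposite-prop i =
    ∸-monoʳ-< (s≤s i<j) (FP.toℕ<n j)

  before-mirror : ∀ {x : Word n} {a b} → IsSigned n x → Before n b a x → Before n (mirror a) (mirror b) x
  before-mirror {x} x-signed (i , j , i<j , refl , refl) =
    opposite j , opposite i , opposite-reverse i<j , signed-opposite {x} x-signed j , signed-opposite {x} x-signed i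

  before-mirror⁻ : ∀ {x : Word n} {a b} → InB n x → Before n (mirror a) (mirror b) x → Before n b a x
  before-mirror⁻ {x} {a} {b} (x-perm , x-signed) ba
    with (1≤ma , _) , (1≤mb , _) ← before-inRange x-perm ba
    = subst₂ (λ u v → Before n u v x) (involutive 1≤mb) (involutive 1≤ma) (before-mirror x-signed ba)
    where
    involutive : ∀ {v} → 1 ≤ mirror v → mirror (mirror v) ≡ v
    involutive 1≤mv = mirror-involutive (<⇒≤ (m∸n≢0⇒n<m (≢-sym (<⇒≢ 1≤mv))))

  inversion-through-large : ∀ {s : Word n} {a b c} → InTam n s → Before n c a s →
                            a < b → b < c → suc n ≤ b → Before n b a s
  inversion-through-large {s} ((s-perm , _) , avoids) ca@(i , j , i<j , si , sj) a<b b<c n<b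
    with c-range , a-range ← before-inRange s-perm ca
    with before-total s-perm (≤-trans (s≤s z≤n) n<b , ≤-trans (<⇒≤ b<c) (proj₂ c-range)) a-range (<⇒≢ a<b ∘ sym)
  ... | inj₁ ba = ba
  ... | inj₂ (j′ , k , j′<k , sj′ , sk) with refl ← proj₂ s-perm j j′ (trans sj (sym sj′)) =
    ⊥-elim (avoids (i , j , k , i<j , j′<k , subst₂ _<_ (sym sj) (sym sk) a<b , subst₂ _<_ (sym sk) (sym si) b<c ,
                    subst (suc n ≤_) (sym sk) n<b))

  inversion-through-small : ∀ {s : Word n} {a b c} → InTam n s → Before n c a s →
                            a < b → b < c → b ≤ n → Before n c b s
  inversion-through-small {s} s-tam@(s-B@(s-perm , s-signed) , _) ca a<b b<c b≤n
    with (_ , c≤N) , _ ← before-inRange s-perm ca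
    = before-mirror⁻ s-B (inversion-through-large s-tam (before-mirror s-signed ca)
        (mirror-reverse b<c (m≤n⇒m≤1+n c≤N)) (mirror-reverse a<b (<⇒≤ (<-≤-trans b<c (m≤n⇒m≤1+n c≤N))))
        (mirror-large b≤n))

  mirrored : Word n → Word n
  mirrored x i = mirror (x (opposite i))

  mirrored-perm : ∀ {x : Word n} → IsPerm n x → IsPerm n (mirrored x)
  mirrored-perm {x} (x-range , x-inj) =
    (λ i → mirror-inRange (x-range (opposite i))) ,
    λ i j eq → begin
      i                       ≡⟨ FP.opposite-involutive i ⟨
      opposite (opposite i)   ≡⟨ cong opposite (x-inj _ _ (begin
        x (opposite i)                    ≡⟨ mirror-involutive-inRange (x-range _) ⟨
        mirror (mirror (x (opposite i)))  ≡⟨ cong mirror eq ⟩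
        mirror (mirror (x (opposite j)))  ≡⟨ mirror-involutive-inRange (x-range _) ⟩
        x (opposite j)                    ∎)) ⟩
      opposite (opposite j)   ≡⟨ FP.opposite-involutive j ⟩
      j                       ∎
    where open ≡-Reasoning

  mirrored-before⁻ : ∀ {x : Word n} {a b} → IsPerm n x → Before n b a (mirrored x) → Before n (mirror a) (mirror b) x
  mirrored-before⁻ (x-range , _) (i , j , i<j , refl , refl) =
    opposite j , opposite i , opposite-reverse i<j ,
    sym (mirror-involutive-inRange (x-range _)) , sym (mirror-involutive-inRange (x-range _))

  mirrored-before : ∀ {x : Word n} {a b} → InRange a → InRange b → Before n (mirror a) (mirror b) x →
                    Before n b a (mirrored x)
  mirrored-before {x} a-range b-range (i , j , i<j , xi , xj) =
    opposite j , opposite i , opposite-reverse i<j ,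
    trans (cong (mirror ∘ x) (FP.opposite-involutive j)) (trans (cong mirror xj) (mirror-involutive-inRange b-range)) ,
    trans (cong (mirror ∘ x) (FP.opposite-involutive i)) (trans (cong mirror xi) (mirror-involutive-inRange a-range))

  mirrored-fixed⇒signed : ∀ {x : Word n} → IsPerm n x → WordEq n x (mirrored x) → IsSigned n x
  mirrored-fixed⇒signed {x} (x-range , _) x≡mx i = begin
    x i + x (opposite i)                     ≡⟨ cong (x i +_) (x≡mx (opposite i)) ⟩
    x i + mirror (x (opposite (opposite i))) ≡⟨ cong (λ j → x i + mirror (x j)) (FP.opposite-involutive i) ⟩
    x i + mirror (x i)                       ≡⟨ m+[n∸m]≡n (m≤n⇒m≤1+n (proj₂ (x-range i))) ⟩
    suc N                                    ∎
    where open ≡-Reasoning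

  opposite-firstHalf : ∀ (i : Fin N) → toℕ i < n → n ≤ toℕ (opposite i)
  opposite-firstHalf i i<n rewrite FP.opposite-prop i =
    subst (_≤ N ∸ suc (toℕ i)) (m+n∸n≡m n n) (∸-monoʳ-≤ N i<n)

  opposite-secondHalf : ∀ (i : Fin N) → n ≤ toℕ i → toℕ (opposite i) < n
  opposite-secondHalf i n≤i rewrite FP.opposite-prop i =
    subst (N ∸ suc (toℕ i) <_) (m+n∸n≡m n n) (∸-monoʳ-< (s≤s n≤i) (FP.toℕ<n i))

  ¬N-before-1-downward : 1 ≤ n → ∀ {m z : Word n} → WeakLe n m z → ¬ Before n N 1 z → ¬ Before n N 1 m
  ¬N-before-1-downward 1≤n m≤z ¬N1 N1 = ¬N1 (m≤z 1 N (+-mono-≤ 1≤n 1≤n) N1)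

  N-secondHalf : 1 ≤ n → ∀ {m : Word n} → InB n m → ¬ Before n N 1 m → ∃ λ i → m i ≡ N × n ≤ toℕ i
  N-secondHalf 1≤n {m} (m-perm , m-signed) ¬N1
    with i , mi≡N ← perm-surjective m-perm (≤-trans 1≤n (m≤m+n n n) , ≤-refl)
    with n ≤? toℕ i
  ... | yes n≤i = i , mi≡N , n≤i
  ... | no n≰i = ⊥-elim (¬N1 (i , opposite i , <-≤-trans i<n (opposite-firstHalf i i<n) , mi≡N ,
                              trans (signed-opposite {m} m-signed i) (trans (cong mirror mi≡N) (m+n∸n≡m 1 N))))
    where
    i<n : toℕ i < n
    i<n = ≰⇒> n≰i

true⇒witness : ∀ {A : Set} (a? : Dec A) → does a? ≡ true → A
true⇒witness (yes a) _ = a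

module WordOfOrder (n : ℕ) (_≺_ : ℕ → ℕ → Set) (_≺?_ : ∀ u v → Dec (u ≺ v))
  (≺-irrefl : ∀ u → ¬ u ≺ u)
  (≺-total : ∀ {u v} → Permutations.InRange n u → Permutations.InRange n v → u ≢ v → u ≺ v ⊎ v ≺ u)
  (≺-trans : ∀ {u v w} → Permutations.InRange n u → Permutations.InRange n v → Permutations.InRange n w →
             u ≺ v → v ≺ w → u ≺ w) where
  open Permutations n

  value : Fin N → ℕ
  value u = suc (toℕ u)

  value-inRange : ∀ u → InRange (value u)
  value-inRange u = s≤s z≤n , FP.toℕ<n u

  value-injective : ∀ {u v} → value u ≡ value v → u ≡ v
  value-injective = FP.toℕ-injective ∘ suc-injective

  rank : Fin N → ℕ
  rank v = count (λ u → does (value u ≺? value v))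

  rank<N : ∀ v → rank v < N
  rank<N v = count<-if-false _ v (dec-false (value v ≺? value v) (≺-irrefl _))

  rank-strict : ∀ {u v} → value u ≺ value v → rank u < rank v
  rank-strict {u} {v} u≺v =
    count-strict _ _ (λ w w≺u → dec-true (_ ≺? _) (≺-trans (value-inRange w) (value-inRange u) (value-inRange v)
                                                     (true⇒witness (_ ≺? _) w≺u) u≺v))
                 u (dec-true (_ ≺? _) u≺v) (dec-false (_ ≺? _) (≺-irrefl _))

  rank-injective : ∀ {u v} → rank u ≡ rank v → u ≡ v
  rank-injective {u} {v} eq with u FP.≟ v
  ... | yes u≡v = u≡v
  ... | no u≢v with ≺-total (value-inRange u) (value-inRange v) (u≢v ∘ value-injective)
  ...   | inj₁ u≺v = ⊥-elim (<-irrefl eq (rank-strict u≺v))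
  ...   | inj₂ v≺u = ⊥-elim (<-irrefl (sym eq) (rank-strict v≺u))

  ofRank : ∀ (i : Fin N) → ∃ λ v → rank v ≡ toℕ i
  ofRank i = bounded-injection-surjective rank rank<N rank-injective (FP.toℕ<n i)

  opaque
    word : Word n
    word i = value (proj₁ (ofRank i))

    word-perm : IsPerm n word
    word-perm = (λ i → value-inRange (proj₁ (ofRank i))) ,
                λ i j eq → FP.toℕ-injective (trans (sym (proj₂ (ofRank i)))
                             (trans (cong rank (value-injective eq)) (proj₂ (ofRank j))))

    before⇒≺ : ∀ {b a} → Before n b a word → b ≺ a
    before⇒≺ (i , j , i<j , refl , refl) with word i ≺? word j
    ... | yes i≺j = i≺j
    ... | no i⊀j with ≺-total (proj₁ word-perm i) (proj₁ word-perm j) (FP.<⇒≢ i<j ∘ proj₂ word-perm i j)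
    ...   | inj₁ i≺j = ⊥-elim (i⊀j i≺j)
    ...   | inj₂ j≺i = ⊥-elim (<-asym i<j (subst₂ _<_ (proj₂ (ofRank j)) (proj₂ (ofRank i)) (rank-strict j≺i)))

    ≺⇒before : ∀ {b a} → b ≺ a → InRange b → InRange a → Before n b a word
    ≺⇒before {b} {a} b≺a b-range a-range
      with i , wi ← perm-surjective word-perm b-range | j , wj ← perm-surjective word-perm a-range
      with FP.<-cmp i j
    ... | tri< i<j _ _ = i , j , i<j , wi , wj
    ... | tri≈ _ refl _ = ⊥-elim (≺-irrefl _ (subst (b ≺_) (trans (sym wj) wi) b≺a))
    ... | tri> _ _ j<i = ⊥-elim (≺-irrefl _ (≺-trans b-range a-range b-range b≺a (before⇒≺ (j , i , j<i , wj , wi))))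

module TamMeet (n : ℕ) (S : List (Word n)) (S-tam : All (InTam n) S) where
  open Permutations n

  AllBefore : ℕ → ℕ → Set
  AllBefore b a = All (Before n b a) S

  allBefore? : ∀ b a → Dec (AllBefore b a)
  allBefore? b a = All.all? (λ s → before? b a s) S

  allBefore-trans : ∀ {a b c} → AllBefore c b → AllBefore b a → AllBefore c a
  allBefore-trans cb ba =
    All.zipWith (λ { (((s-perm , _) , _) , cb , ba) → before-trans s-perm cb ba }) (S-tam , All.zip (cb , ba))

  allBefore-split : ∀ {a b c} → a < b → b < c → AllBefore c a → AllBefore b a ⊎ AllBefore c b
  allBefore-split {b = b} a<b b<c ca with suc n ≤? b
  ... | yes n<b = inj₁ (All.zipWith (λ (s-tam , ca) → inversion-through-large s-tam ca a<b b<c n<b) (S-tam , ca))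
  ... | no n≮b  = inj₂ (All.zipWith (λ (s-tam , ca) → inversion-through-small s-tam ca a<b b<c (≤-pred (≰⇒> n≮b)))
                                    (S-tam , ca))

  -- u ≺ v: u precedes v in the meet, which keeps the common inversions and orders every other pair increasingly.
  _≺_ : ℕ → ℕ → Set
  u ≺ v = (v < u × AllBefore u v) ⊎ (u < v × ¬ AllBefore v u)

  _≺?_ : ∀ u v → Dec (u ≺ v)
  u ≺? v = ((v <? u) ×-dec allBefore? u v) ⊎-dec ((u <? v) ×-dec ¬? (allBefore? v u))

  ≺-irrefl : ∀ u → ¬ u ≺ u
  ≺-irrefl u (inj₁ (u<u , _)) = <-irrefl refl u<u
  ≺-irrefl u (inj₂ (u<u , _)) = <-irrefl refl u<u

  ≺-total : ∀ {u v} → InRange u → InRange v → u ≢ v → u ≺ v ⊎ v ≺ u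
  ≺-total {u} {v} _ _ u≢v with <-cmp u v
  ... | tri≈ _ u≡v _ = ⊥-elim (u≢v u≡v)
  ... | tri< u<v _ _ with allBefore? v u
  ...   | yes vu = inj₂ (inj₁ (u<v , vu))
  ...   | no ¬vu = inj₁ (inj₂ (u<v , ¬vu))
  ≺-total {u} {v} _ _ u≢v | tri> _ _ v<u with allBefore? u v
  ...   | yes uv = inj₁ (inj₁ (v<u , uv))
  ...   | no ¬uv = inj₂ (inj₂ (v<u , ¬uv))

  ≺-trans : ∀ {u v w} → InRange u → InRange v → InRange w → u ≺ v → v ≺ w → u ≺ w
  ≺-trans _ _ _ (inj₁ (v<u , uv)) (inj₁ (w<v , vw)) = inj₁ (<-trans w<v v<u , allBefore-trans uv vw)
  ≺-trans _ _ _ (inj₂ (u<v , ¬vu)) (inj₂ (v<w , ¬wv)) =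
    inj₂ (<-trans u<v v<w , [ ¬vu , ¬wv ]′ ∘ allBefore-split u<v v<w)
  ≺-trans {u} {v} {w} _ _ _ (inj₁ (v<u , uv)) (inj₂ (v<w , ¬wv)) with <-cmp u w
  ... | tri< u<w _ _ = inj₂ (u<w , λ wu → ¬wv (allBefore-trans wu uv))
  ... | tri≈ _ refl _ = ⊥-elim (¬wv uv)
  ... | tri> _ _ w<u = inj₁ (w<u , [ ⊥-elim ∘ ¬wv , (λ uw → uw) ]′ (allBefore-split v<w w<u uv))
  ≺-trans {u} {v} {w} _ _ _ (inj₂ (u<v , ¬vu)) (inj₁ (w<v , vw)) with <-cmp u w
  ... | tri< u<w _ _ = inj₂ (u<w , λ wu → ¬vu (allBefore-trans vw wu))
  ... | tri≈ _ refl _ = ⊥-elim (¬vu vw)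
  ... | tri> _ _ w<u = inj₁ (w<u , [ (λ uw → uw) , ⊥-elim ∘ ¬vu ]′ (allBefore-split w<u u<v vw))

  open WordOfOrder n _≺_ _≺?_ ≺-irrefl ≺-total ≺-trans
    public renaming (word to meet; word-perm to meet-perm; before⇒≺ to meet-before⇒≺; ≺⇒before to ≺⇒meet-before)

  ≺-mirror : ∀ {u v} → InRange u → InRange v → u ≺ v → mirror v ≺ mirror u
  ≺-mirror u-range v-range (inj₁ (v<u , uv)) =
    inj₁ (mirror-reverse v<u (m≤n⇒m≤1+n (proj₂ u-range)) ,
          All.zipWith (λ (s-tam , uv) → before-mirror (proj₂ (proj₁ s-tam)) uv) (S-tam , uv))
  ≺-mirror u-range v-range (inj₂ (u<v , ¬vu)) =
    inj₂ (mirror-reverse u<v (m≤n⇒m≤1+n (proj₂ v-range)) ,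
          λ mu-mv → ¬vu (All.zipWith (λ (s-tam , mu-mv) → before-mirror⁻ (proj₁ s-tam) mu-mv) (S-tam , mu-mv)))

  meet≤mirrored : WeakLe n meet (mirrored meet)
  meet≤mirrored a b a<b ba with b-range , a-range ← before-inRange meet-perm ba =
    mirrored-before a-range b-range
      (≺⇒meet-before (≺-mirror b-range a-range (meet-before⇒≺ ba)) (mirror-inRange a-range) (mirror-inRange b-range))

  mirrored≤meet : WeakLe n (mirrored meet) meet
  mirrored≤meet a b a<b ba with b-range , a-range ← before-inRange (mirrored-perm meet-perm) ba =
    ≺⇒meet-before (subst₂ _≺_ (mirror-involutive-inRange b-range) (mirror-involutive-inRange a-range)
                     (≺-mirror (mirror-inRange a-range) (mirror-inRange b-range)
                       (meet-before⇒≺ (mirrored-before⁻ meet-perm ba))))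
                  b-range a-range

  meet-signed : IsSigned n meet
  meet-signed = mirrored-fixed⇒signed meet-perm
                  (weakLe-antisym meet-perm (mirrored-perm meet-perm) meet≤mirrored mirrored≤meet)

  meet-avoids : ¬ Has312* n meet
  meet-avoids (i , j , k , i<j , j<k , mj<mk , mk<mi , n<mk) with meet-before⇒≺ (i , j , i<j , refl , refl)
  ... | inj₂ (mi<mj , _) = <-asym mi<mj (<-trans mj<mk mk<mi)
  ... | inj₁ (_ , common-ij) =
    before-asym meet-perm (j , k , j<k , refl , refl)
      (≺⇒meet-before (inj₁ (mj<mk , All.zipWith (λ (s-tam , ij) → inversion-through-large s-tam ij mj<mk mk<mi n<mk)
                                                  (S-tam , common-ij)))
                     (proj₁ meet-perm k) (proj₁ meet-perm j))

  meet-tam : InTam n meet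
  meet-tam = (meet-perm , meet-signed) , meet-avoids

  meet-lower : ∀ {s} → s ∈ S → WeakLe n meet s
  meet-lower s∈S a b a<b ba with meet-before⇒≺ ba
  ... | inj₁ (_ , common-ba) = All.lookup common-ba s∈S
  ... | inj₂ (b<a , _) = ⊥-elim (<-asym a<b b<a)

  meet-greatest : ∀ {z} → IsPerm n z → All (WeakLe n z) S → WeakLe n z meet
  meet-greatest z-perm z≤S a b a<b ba with b-range , a-range ← before-inRange z-perm ba =
    ≺⇒meet-before (inj₁ (a<b , All.map (λ z≤s → z≤s a b a<b ba) z≤S)) b-range a-range

module FiniteTam (n : ℕ) where
  open Permutations n

  inTam-resp : ∀ {z z′ : Word n} → WordEq n z z′ → InTam n z → InTam n z′
  inTam-resp {z} {z′} e (((z-range , z-inj) , z-signed) , z-avoids) =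
    (((λ i → subst InRange (e i) (z-range i)) , (λ i j eq → z-inj i j (trans (e i) (trans eq (sym (e j)))))) ,
     (λ i → subst₂ (λ u v → u + v ≡ suc N) (e i) (e (opposite i)) (z-signed i))) ,
    λ (i , j , k , i<j , j<k , jk , ki , n<k) → z-avoids (i , j , k , i<j , j<k ,
      subst₂ _<_ (sym (e j)) (sym (e k)) jk , subst₂ _<_ (sym (e k)) (sym (e i)) ki , subst (suc n ≤_) (sym (e k)) n<k)

  covered-resp : ∀ {y y′ x : Word n} → WordEq n y y′ → CoveredInTam n y x → CoveredInTam n y′ x
  covered-resp y≡y′ (y-tam , y≤x , y≢x , between) =
    inTam-resp y≡y′ y-tam , weakLe-respˡ y≡y′ y≤x , (λ y′≡x → y≢x (wordEq-trans y≡y′ y′≡x)) ,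
    λ z z-tam y′≤z z≤x → Sum.map₁ (λ z≡y → wordEq-trans z≡y y≡y′)
                           (between z z-tam (weakLe-respˡ (wordEq-sym y≡y′) y′≤z) z≤x)

  weakLe? : ∀ y z → Dec (WeakLe n y z)
  weakLe? y z = map′ (λ h a b a<b → λ { (i , j , i<j , refl , refl) → h i j i<j a<b })
                     (λ h i j i<j y<y → h _ _ y<y (i , j , i<j , refl , refl))
                     (FP.all? λ i → FP.all? λ j → (i FP.<? j) →-dec (y j <? y i) →-dec before? (y i) (y j) z)

  wordEq? : ∀ y z → Dec (WordEq n y z)
  wordEq? y z = FP.all? λ i → y i ≟ z i

  inTam? : ∀ y → Dec (InTam n y)
  inTam? y = (((FP.all? λ i → (1 ≤? y i) ×-dec (y i ≤? N)) ×-dec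
               (FP.all? λ i → FP.all? λ j → (y i ≟ y j) →-dec (i FP.≟ j))) ×-dec
              (FP.all? λ i → y i + y (opposite i) ≟ suc N)) ×-dec
             ¬? (FP.any? λ i → FP.any? λ j → FP.any? λ k → (i FP.<? j) ×-dec (j FP.<? k) ×-dec
                   (y j <? y k) ×-dec (y k <? y i) ×-dec (suc n ≤? y k))

  codes : ∀ k → List (Vec (Fin N) k)
  codes zero    = [] ∷ []
  codes (suc k) = concatMap (λ a → List.map (a ∷_) (codes k)) (allFin N)

  ∈-codes : ∀ {k} (c : Vec (Fin N) k) → c ∈ codes k
  ∈-codes []      = here refl
  ∈-codes (a ∷ c) = ∈-concatMap⁺ (λ a → List.map (a ∷_) (codes _))
                      (Any.map (λ { refl → ∈-map⁺ (a ∷_) (∈-codes c) }) (∈-allFin a))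

  decode : Vec (Fin N) N → Word n
  decode c i = suc (toℕ (Vec.lookup c i))

  encode : (z : Word n) → (∀ i → InRange (z i)) → Vec (Fin N) N
  encode z z-range = Vec.tabulate λ i → fromℕ< (pred<N (z-range i))

  decode-encode : ∀ z z-range → WordEq n (decode (encode z z-range)) z
  decode-encode z z-range i = begin
    suc (toℕ (Vec.lookup (encode z z-range) i)) ≡⟨ cong (suc ∘ toℕ) (VP.lookup∘tabulate _ i) ⟩
    suc (toℕ (fromℕ< (pred<N (z-range i))))     ≡⟨ cong suc (FP.toℕ-fromℕ< _) ⟩
    suc (ℕ.pred (z i))                           ≡⟨ suc-pred-inRange (z-range i) ⟩
    z i                                          ∎
    where open ≡-Reasoning

  covered? : ∀ x y → Dec (CoveredInTam n y x)
  covered? x y = inTam? y ×-dec weakLe? y x ×-dec ¬? (wordEq? y x) ×-dec onlyEnds?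
    where
    Ends : Word n → Set
    Ends z = InTam n z → WeakLe n y z → WeakLe n z x → WordEq n z y ⊎ WordEq n z x

    ends? : ∀ z → Dec (Ends z)
    ends? z = inTam? z →-dec weakLe? y z →-dec weakLe? z x →-dec (wordEq? z y ⊎-dec wordEq? z x)

    codes-suffice : All (Ends ∘ decode) (codes N) → ∀ z → Ends z
    codes-suffice ends z z-tam y≤z z≤x =
      Sum.map (wordEq-trans (wordEq-sym dz≡z)) (wordEq-trans (wordEq-sym dz≡z))
        (All.lookup ends (∈-codes (encode z z-range))
          (inTam-resp (wordEq-sym dz≡z) z-tam) (weakLe-respʳ (wordEq-sym dz≡z) y≤z) (weakLe-respˡ (wordEq-sym dz≡z) z≤x))
      where
      z-range : ∀ i → InRange (z i)
      z-range = proj₁ (proj₁ (proj₁ z-tam))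
      dz≡z : WordEq n (decode (encode z z-range)) z
      dz≡z = decode-encode z z-range

    onlyEnds? : Dec (∀ z → Ends z)
    onlyEnds? = map′ codes-suffice (λ ends → All.tabulate λ {c} _ → ends (decode c))
                     (All.all? (ends? ∘ decode) (codes N))

  opaque
    lowerCovers : Word n → List (Word n)
    lowerCovers x = List.map decode (filter (covered? x ∘ decode) (codes N))

    lowerCovers-covered : ∀ {x w} → w ∈ lowerCovers x → CoveredInTam n w x
    lowerCovers-covered {x} w∈ with c , c∈ , refl ← ∈-map⁻ decode w∈ =
      proj₂ (∈-filter⁻ (covered? x ∘ decode) {xs = codes N} c∈)

    covered⇒∈lowerCovers : ∀ {x y} → CoveredInTam n y x → ∃ λ w → w ∈ lowerCovers x × WordEq n w y
    covered⇒∈lowerCovers {x} {y} y⋖x =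
      decode c , ∈-map⁺ decode (∈-filter⁺ (covered? x ∘ decode) (∈-codes c) (covered-resp (wordEq-sym dc≡y) y⋖x)) , dc≡y
      where
      y-range : ∀ i → InRange (y i)
      y-range = proj₁ (proj₁ (proj₁ (proj₁ y⋖x)))
      c : Vec (Fin N) N
      c = encode y y-range
      dc≡y : WordEq n (decode c) y
      dc≡y = decode-encode y y-range

greatest-≤ : (P : ℕ → Set) → (∀ k → Dec (P k)) → P 0 → ∀ b →
             ∃ λ q → q ≤ b × P q × (∀ k → q < k → k ≤ b → ¬ P k)
greatest-≤ P P? P0 zero = 0 , z≤n , P0 , λ { k 0<k z≤n _ → <-irrefl refl 0<k }
greatest-≤ P P? P0 (suc b) with P? (suc b)
... | yes Pb = suc b , ≤-refl , Pb , λ k b<k k≤b _ → <-irrefl refl (<-≤-trans b<k k≤b)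
... | no ¬Pb with q , q≤b , Pq , q-greatest ← greatest-≤ P P? P0 b =
  q , m≤n⇒m≤1+n q≤b , Pq , λ k q<k k≤1+b → case k ≟ suc b of λ where
    (yes refl) → ¬Pb
    (no k≢1+b) → q-greatest k q<k (≤-pred (≤∧≢⇒< k≤1+b k≢1+b))

argmin : ∀ {k} (P : Fin k → Set) → (∀ i → Dec (P i)) → (f : Fin k → ℕ) → ∃ P →
         ∃ λ r → P r × (∀ j → P j → f r ≤ f j)
argmin {suc k} P P? f (w , Pw) with FP.any? (P? ∘ F.suc)
... | no ¬P-suc = F.zero , P-zero w Pw , minimal
  where
  P-zero : ∀ w → P w → P F.zero
  P-zero F.zero    Pw = Pw
  P-zero (F.suc w) Pw = ⊥-elim (¬P-suc (w , Pw))
  minimal : ∀ j → P j → f F.zero ≤ f j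
  minimal F.zero    _  = ≤-refl
  minimal (F.suc j) Pj = ⊥-elim (¬P-suc (j , Pj))
... | yes P-suc with r , Pr , r-min ← argmin (P ∘ F.suc) (P? ∘ F.suc) (f ∘ F.suc) P-suc
                   with P? F.zero | f F.zero ≤? f (F.suc r)
...   | yes P0 | yes f0≤fr = F.zero , P0 , minimal
  where
  minimal : ∀ j → P j → f F.zero ≤ f j
  minimal F.zero    _  = ≤-refl
  minimal (F.suc j) Pj = ≤-trans f0≤fr (r-min j Pj)
...   | yes P0 | no f0≰fr = F.suc r , Pr , minimal
  where
  minimal : ∀ j → P j → f (F.suc r) ≤ f j
  minimal F.zero    _  = <⇒≤ (≰⇒> f0≰fr)
  minimal (F.suc j) Pj = r-min j Pj
...   | no ¬P0 | _ = F.suc r , Pr , minimal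
  where
  minimal : ∀ j → P j → f (F.suc r) ≤ f j
  minimal F.zero    P0 = ⊥-elim (¬P0 P0)
  minimal (F.suc j) Pj = r-min j Pj

module BlockSwap (n q : ℕ) (q≤n : q ≤ n) where

  N : ℕ
  N = n + n

  L : ℕ
  L = n ∸ q

  L≤n : L ≤ n
  L≤n = m∸n≤m n q

  Left Right : ℕ → Set
  Left t = q ≤ t × t < n
  Right t = n ≤ t × t < n + L

  Left⇒¬Right : ∀ {t} → Left t → ¬ Right t
  Left⇒¬Right (_ , t<n) (n≤t , _) = <-irrefl refl (<-≤-trans t<n n≤t)

  data Region (t : ℕ) : Set where
    inLeft  : Left t → Region t
    inRight : Right t → Region t
    outside : ¬ Left t → ¬ Right t → Region t

  region : ∀ t → Region t
  region t with (q ≤? t) ×-dec (t <? n) | (n ≤? t) ×-dec (t <? n + L)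
  ... | yes a | _     = inLeft a
  ... | no ¬a | yes b = inRight b
  ... | no ¬a | no ¬b = outside ¬a ¬b

  shift : ∀ {t} → Region t → ℕ
  shift {t} (inLeft _)    = t + L
  shift {t} (inRight _)   = t ∸ L
  shift {t} (outside _ _) = t

  opaque
    swap : ℕ → ℕ
    swap t = shift (region t)

    swap-left : ∀ {t} → Left t → swap t ≡ t + L
    swap-left {t} a with region t
    ... | inLeft _     = refl
    ... | inRight b    = ⊥-elim (Left⇒¬Right a b)
    ... | outside ¬a _ = ⊥-elim (¬a a)

    swap-right : ∀ {t} → Right t → swap t ≡ t ∸ L
    swap-right {t} b with region t
    ... | inLeft a     = ⊥-elim (Left⇒¬Right a b)
    ... | inRight _    = refl
    ... | outside _ ¬b = ⊥-elim (¬b b)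

    swap-outside : ∀ {t} → ¬ Left t → ¬ Right t → swap t ≡ t
    swap-outside {t} ¬a ¬b with region t
    ... | inLeft a    = ⊥-elim (¬a a)
    ... | inRight b   = ⊥-elim (¬b b)
    ... | outside _ _ = refl

  q+L≡n : q + L ≡ n
  q+L≡n = m+[n∸m]≡n q≤n

  Left⇒Right-shifted : ∀ {t} → Left t → Right (t + L)
  Left⇒Right-shifted {t} (q≤t , t<n) = subst (_≤ t + L) q+L≡n (+-monoˡ-≤ L q≤t) , +-monoˡ-< L t<n

  Right⇒Left-shifted : ∀ {t} → Right t → Left (t ∸ L)
  Right⇒Left-shifted {t} (n≤t , t<n+L) =
    m+n≤o⇒m≤o∸n q (subst (_≤ t) (sym q+L≡n) n≤t) ,
    subst (t ∸ L <_) (m+n∸n≡m n L) (∸-monoˡ-< t<n+L (≤-trans L≤n n≤t))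

  swap-involutive : ∀ t → swap (swap t) ≡ t
  swap-involutive t with region t
  ... | inLeft a rewrite swap-left a | swap-right (Left⇒Right-shifted a) = m+n∸n≡m t L
  ... | inRight b@(n≤t , _) rewrite swap-right b | swap-left (Right⇒Left-shifted b) = m∸n+n≡m (≤-trans L≤n n≤t)
  ... | outside ¬a ¬b rewrite swap-outside ¬a ¬b | swap-outside ¬a ¬b = refl

  swap-< : ∀ {t} → t < N → swap t < N
  swap-< {t} t<N with region t
  ... | inLeft a@(_ , t<n) rewrite swap-left a = <-≤-trans (+-monoˡ-< L t<n) (+-monoʳ-≤ n L≤n)
  ... | inRight b rewrite swap-right b = ≤-<-trans (m∸n≤m t L) t<N
  ... | outside ¬a ¬b rewrite swap-outside ¬a ¬b = t<N

  outside-below : ∀ {s t} → ¬ Left s → ¬ Right s → s < t → t < n + L → s < q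
  outside-below {s} ¬a ¬b s<t t<n+L with s <? q | s <? n
  ... | yes s<q | _       = s<q
  ... | no s≮q  | yes s<n = ⊥-elim (¬a (≮⇒≥ s≮q , s<n))
  ... | no _    | no s≮n  = ⊥-elim (¬b (≮⇒≥ s≮n , <-trans s<t t<n+L))

  outside-above : ∀ {s t} → ¬ Left t → ¬ Right t → s < t → q ≤ s → n + L ≤ t
  outside-above {s} {t} ¬a ¬b s<t q≤s with t <? n | t <? n + L
  ... | yes t<n | _         = ⊥-elim (¬a (≤-trans q≤s (<⇒≤ s<t) , t<n))
  ... | no t≮n  | yes t<n+L = ⊥-elim (¬b (≮⇒≥ t≮n , t<n+L))
  ... | no _    | no t≮n+L  = ≮⇒≥ t≮n+L

  swap-monotone : ∀ {s t} → s < t → ¬ (Left s × Right t) → swap s < swap t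
  swap-monotone {s} {t} s<t ¬LR with region s | region t
  ... | inLeft a | inLeft a′ rewrite swap-left a | swap-left a′ = +-monoˡ-< L s<t
  ... | inLeft a | inRight b = ⊥-elim (¬LR (a , b))
  ... | inLeft a@(q≤s , s<n) | outside ¬a ¬b rewrite swap-left a | swap-outside ¬a ¬b =
    <-≤-trans (+-monoˡ-< L s<n) (outside-above ¬a ¬b s<t q≤s)
  ... | inRight (n≤s , _) | inLeft (_ , t<n) = ⊥-elim (<-irrefl refl (<-trans (<-≤-trans t<n n≤s) s<t))
  ... | inRight b@(n≤s , _) | inRight b′ rewrite swap-right b | swap-right b′ = ∸-monoˡ-< s<t (≤-trans L≤n n≤s)
  ... | inRight b | outside ¬a ¬b rewrite swap-right b | swap-outside ¬a ¬b = ≤-<-trans (m∸n≤m s L) s<t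
  ... | outside ¬a ¬b | inLeft a@(q≤t , t<n) rewrite swap-outside ¬a ¬b | swap-left a =
    <-≤-trans (outside-below ¬a ¬b s<t (<-≤-trans t<n (m≤m+n n L))) (≤-trans q≤t (m≤m+n t L))
  ... | outside ¬a ¬b | inRight b@(_ , t<n+L) rewrite swap-outside ¬a ¬b | swap-right b =
    <-≤-trans (outside-below ¬a ¬b s<t t<n+L) (proj₁ (Right⇒Left-shifted b))
  ... | outside ¬a ¬b | outside ¬a′ ¬b′ rewrite swap-outside ¬a ¬b | swap-outside ¬a′ ¬b′ = s<t

  swap-crossing : ∀ {s t} → Left s → Right t → swap t < swap s
  swap-crossing a b rewrite swap-left a | swap-right b =
    <-≤-trans (proj₂ (Right⇒Left-shifted b)) (proj₁ (Left⇒Right-shifted a))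

  reflect : ℕ → ℕ
  reflect t = N ∸ suc t

  reflect-involutive : ∀ {t} → t < N → reflect (reflect t) ≡ t
  reflect-involutive {t} t<N = trans (sym (pred[m∸n]≡m∸[1+n] N (N ∸ suc t))) (cong ℕ.pred (m∸[m∸n]≡n t<N))

  Left⇒Right-reflect : ∀ {s} → Left s → Right (reflect s)
  Left⇒Right-reflect {s} (q≤s , s<n) =
    subst (_≤ reflect s) (m+n∸n≡m n n) (∸-monoʳ-≤ N s<n) ,
    subst (reflect s <_) (+-∸-assoc n q≤n) (∸-monoʳ-< (s≤s q≤s) (≤-trans s<n (m≤m+n n n)))

  Right⇒Left-reflect : ∀ {s} → Right s → Left (reflect s)
  Right⇒Left-reflect {s} (n≤s , s<n+L) =
    m+n≤o⇒m≤o∸n q (subst (q + suc s ≤_) q+n+L≡N (+-monoʳ-≤ q s<n+L)) ,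
    subst (reflect s <_) (m+n∸n≡m n n) (∸-monoʳ-< (s≤s n≤s) (≤-trans s<n+L (+-monoʳ-≤ n L≤n)))
    where
    q+n+L≡N : q + (n + L) ≡ N
    q+n+L≡N = begin
      q + (n + L) ≡⟨ +-assoc q n L ⟨
      q + n + L   ≡⟨ cong (_+ L) (+-comm q n) ⟩
      n + q + L   ≡⟨ +-assoc n q L ⟩
      n + (q + L) ≡⟨ cong (n +_) q+L≡n ⟩
      N           ∎
      where open ≡-Reasoning

  swap-reflect-left : ∀ {s} → Left s → swap (reflect s) ≡ reflect (swap s)
  swap-reflect-left {s} a rewrite swap-left a | swap-right (Left⇒Right-reflect a) = ∸-+-assoc N (suc s) L

  swap-reflect : ∀ {t} → t < N → swap (reflect t) ≡ reflect (swap t)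
  swap-reflect {t} t<N with region t
  ... | inLeft a = swap-reflect-left a
  ... | inRight b = begin
    swap (reflect t)               ≡⟨ cong (swap ∘ reflect) (swap-involutive t) ⟨
    swap (reflect (swap (swap t))) ≡⟨ cong swap (swap-reflect-left sa) ⟨
    swap (swap (reflect (swap t))) ≡⟨ swap-involutive _ ⟩
    reflect (swap t)               ∎
    where
    open ≡-Reasoning
    sa : Left (swap t)
    sa = subst Left (sym (swap-right b)) (Right⇒Left-shifted b)
  ... | outside ¬a ¬b rewrite swap-outside ¬a ¬b = swap-outside
    (λ a → ¬b (subst Right (reflect-involutive t<N) (Left⇒Right-reflect a)))
    (λ b → ¬a (subst Left (reflect-involutive t<N) (Right⇒Left-reflect b)))

module SwapCover (n : ℕ) (1≤n : 1 ≤ n) (x : Word n) (x-tam : InTam n x) (N-before-1 : Before n (n + n) 1 x) where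
  open Permutations n

  x-perm : IsPerm n x
  x-perm = proj₁ (proj₁ x-tam)

  x-signed : IsSigned n x
  x-signed = proj₂ (proj₁ x-tam)

  x-range : ∀ i → InRange (x i)
  x-range = proj₁ x-perm

  x-inj : ∀ i j → x i ≡ x j → i ≡ j
  x-inj = proj₂ x-perm

  x-avoids : ¬ Has312* n x
  x-avoids = proj₂ x-tam

  x-distinct : ∀ {i j : Fin N} → toℕ i < toℕ j → x i ≢ x j
  x-distinct i<j xi≡xj = FP.<⇒≢ i<j (x-inj _ _ xi≡xj)

  x-opposite : ∀ i → x (opposite i) ≡ mirror (x i)
  x-opposite = signed-opposite {x} x-signed

  n<N : n < N
  n<N = subst (_≤ N) (+-comm n 1) (+-monoʳ-≤ n 1≤n)

  firstHalf-≢1 : ∀ i → toℕ i < n → x i ≢ 1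
  firstHalf-≢1 i i<n xi≡1 = before-asym x-perm N-before-1
    (i , opposite i , <-≤-trans i<n (opposite-firstHalf i i<n) , xi≡1 , trans (x-opposite i) (cong mirror xi≡1))

  -- N before the small value b = x i forces the pattern N … b … mirror b.
  firstHalf-¬middle : ∀ i → toℕ i < n → 1 < x i → ¬ x i ≤ n
  firstHalf-¬middle i i<n 1<xi xi≤n
    with k , i′ , k<i′ , xk≡N , xi′≡xi ←
           inversion-through-small x-tam N-before-1 1<xi (<-≤-trans (s≤s xi≤n) n<N) xi≤n
    with refl ← x-inj i′ i xi′≡xi
    = x-avoids (k , i , opposite i , k<i′ , <-≤-trans i<n (opposite-firstHalf i i<n) ,
                subst (x i <_) (sym (x-opposite i)) (<-≤-trans (s≤s xi≤n) (mirror-large xi≤n)) ,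
                subst₂ _<_ (sym (x-opposite i)) (sym xk≡N) (mirror-reverse 1<xi (m≤n⇒m≤1+n (proj₂ (x-range i)))) ,
                subst (suc n ≤_) (sym (x-opposite i)) (mirror-large xi≤n))

  firstHalf-large : ∀ i → toℕ i < n → suc n ≤ x i
  firstHalf-large i i<n with suc n ≤? x i
  ... | yes n<xi = n<xi
  ... | no n≮xi = ⊥-elim (firstHalf-¬middle i i<n
                    (≤∧≢⇒< (proj₁ (x-range i)) (firstHalf-≢1 i i<n ∘ sym)) (≤-pred (≰⇒> n≮xi)))

  secondHalf-small : ∀ i → n ≤ toℕ i → x i ≤ n
  secondHalf-small i n≤i =
    subst (_≤ n) (trans (sym (x-opposite (opposite i))) (cong x (FP.opposite-involutive i)))
      (mirror-small (firstHalf-large (opposite i) (opposite-secondHalf i n≤i)))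

  p : Fin N
  p = proj₁ N-before-1

  xp≡N : x p ≡ N
  xp≡N = proj₁ (proj₂ (proj₂ (proj₂ N-before-1)))

  x-opposite-p≡1 : x (opposite p) ≡ 1
  x-opposite-p≡1 = trans (x-opposite p) (trans (cong mirror xp≡N) (m+n∸n≡m 1 N))

  p<n : toℕ p < n
  p<n with toℕ p <? n
  ... | yes p<n = p<n
  ... | no p≮n = ⊥-elim (<-irrefl refl (<-≤-trans n<N (subst (_≤ n) xp≡N (secondHalf-small p (≮⇒≥ p≮n)))))

  SmallerPrefix : ℕ → Set
  SmallerPrefix k = ∀ (i j : Fin N) → toℕ i < k → k ≤ toℕ j → toℕ j < n → x i < x j

  smallerPrefix? : ∀ k → Dec (SmallerPrefix k)
  smallerPrefix? k = FP.all? λ i → FP.all? λ j →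
    (toℕ i <? k) →-dec (k ≤? toℕ j) →-dec (toℕ j <? n) →-dec (x i <? x j)

  opaque
    q-choice : ∃ λ q → q ≤ toℕ p × SmallerPrefix q × (∀ k → q < k → k ≤ toℕ p → ¬ SmallerPrefix k)
    q-choice = greatest-≤ SmallerPrefix smallerPrefix? (λ _ _ ()) (toℕ p)

  q : ℕ
  q = proj₁ q-choice

  q≤p : q ≤ toℕ p
  q≤p = proj₁ (proj₂ q-choice)

  q-smallerPrefix : SmallerPrefix q
  q-smallerPrefix = proj₁ (proj₂ (proj₂ q-choice))

  q-greatest : ∀ k → q < k → k ≤ toℕ p → ¬ SmallerPrefix k
  q-greatest = proj₂ (proj₂ (proj₂ q-choice))

  open BlockSwap n q (≤-trans q≤p (<⇒≤ p<n)) hiding (N)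

  p-left : Left (toℕ p)
  p-left = q≤p , p<n

  opaque
    r-choice : ∃ λ r → Left (toℕ r) × (∀ j → Left (toℕ j) → x r ≤ x j)
    r-choice = argmin (Left ∘ toℕ) (λ i → (q ≤? toℕ i) ×-dec (toℕ i <? n)) x (p , p-left)

  r : Fin N
  r = proj₁ r-choice

  r-left : Left (toℕ r)
  r-left = proj₁ (proj₂ r-choice)

  r-minimal : ∀ j → Left (toℕ j) → x r ≤ x j
  r-minimal = proj₂ (proj₂ r-choice)

  x-r<later : ∀ j → toℕ r < toℕ j → toℕ j < n → x r < x j
  x-r<later j r<j j<n = ≤∧≢⇒< (r-minimal j (≤-trans (proj₁ r-left) (<⇒≤ r<j) , j<n)) (x-distinct r<j)

  -- If r < p then every entry up to position r is below the rest of the first half, so q was not the greatest choice.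
  p≤r : toℕ p ≤ toℕ r
  p≤r with toℕ p ≤? toℕ r
  ... | yes p≤r = p≤r
  ... | no p≰r = ⊥-elim (q-greatest (suc (toℕ r)) (s≤s (proj₁ r-left)) (≰⇒> p≰r) prefix)
    where
    prefix : SmallerPrefix (suc (toℕ r))
    prefix i j i≤r r<j j<n with toℕ i <? q | toℕ i ≟ toℕ r
    ... | yes i<q | _ = q-smallerPrefix i j i<q (≤-trans (proj₁ r-left) (<⇒≤ r<j)) j<n
    ... | no _ | yes i≡r rewrite FP.toℕ-injective i≡r = x-r<later j r<j j<n
    ... | no _ | no i≢r with <-cmp (x i) (x j)
    ...   | tri< xi<xj _ _ = xi<xj
    ...   | tri≈ _ xi≡xj _ = ⊥-elim (x-distinct (<-≤-trans i≤r r<j) xi≡xj)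
    ...   | tri> _ _ xj<xi = ⊥-elim (x-avoids (i , r , j , ≤∧≢⇒< (≤-pred i≤r) i≢r , r<j ,
                               x-r<later j r<j j<n , xj<xi , firstHalf-large j j<n))

  opaque
    σ : Fin N → Fin N
    σ i = fromℕ< (swap-< (FP.toℕ<n i))

    toℕ-σ : ∀ i → toℕ (σ i) ≡ swap (toℕ i)
    toℕ-σ i = FP.toℕ-fromℕ< _

  σ-involutive : ∀ i → σ (σ i) ≡ i
  σ-involutive i = FP.toℕ-injective (trans (toℕ-σ (σ i)) (trans (cong swap (toℕ-σ i)) (swap-involutive (toℕ i))))

  σ-opposite : ∀ i → σ (opposite i) ≡ opposite (σ i)
  σ-opposite i = FP.toℕ-injective (begin
    toℕ (σ (opposite i))     ≡⟨ toℕ-σ (opposite i) ⟩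
    swap (toℕ (opposite i))  ≡⟨ cong swap (FP.opposite-prop i) ⟩
    swap (reflect (toℕ i))   ≡⟨ swap-reflect (FP.toℕ<n i) ⟩
    reflect (swap (toℕ i))   ≡⟨ cong reflect (toℕ-σ i) ⟨
    reflect (toℕ (σ i))      ≡⟨ FP.opposite-prop (σ i) ⟨
    toℕ (opposite (σ i))     ∎)
    where open ≡-Reasoning

  σ-left : ∀ {i} → Left (toℕ i) → Right (toℕ (σ i))
  σ-left {i} a = subst Right (sym (trans (toℕ-σ i) (swap-left a))) (Left⇒Right-shifted a)

  σ-right : ∀ {i} → Right (toℕ i) → Left (toℕ (σ i))
  σ-right {i} b = subst Left (sym (trans (toℕ-σ i) (swap-right b))) (Right⇒Left-shifted b)

  σ-outside : ∀ {i} → ¬ Left (toℕ i) → ¬ Right (toℕ i) → σ i ≡ i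
  σ-outside {i} ¬a ¬b = FP.toℕ-injective (trans (toℕ-σ i) (swap-outside ¬a ¬b))

  σ-monotone : ∀ {i j} → i F.< j → ¬ (Left (toℕ i) × Right (toℕ j)) → σ i F.< σ j
  σ-monotone {i} {j} i<j ¬LR = subst₂ _<_ (sym (toℕ-σ i)) (sym (toℕ-σ j)) (swap-monotone i<j ¬LR)

  σ-crossing : ∀ {i j} → Left (toℕ i) → Right (toℕ j) → σ j F.< σ i
  σ-crossing {i} {j} a b = subst₂ _<_ (sym (toℕ-σ j)) (sym (toℕ-σ i)) (swap-crossing a b)

  y : Word n
  y = x ∘ σ

  y-σ : ∀ i → y (σ i) ≡ x i
  y-σ i = cong x (σ-involutive i)

  y-perm : IsPerm n y
  y-perm = x-range ∘ σ , λ i j yi≡yj → trans (sym (σ-involutive i)) (trans (cong σ (x-inj _ _ yi≡yj)) (σ-involutive j))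

  y-signed : IsSigned n y
  y-signed i = subst (λ k → x (σ i) + x k ≡ suc N) (sym (σ-opposite i)) (x-signed (σ i))

  left-large : ∀ {i} → Left (toℕ i) → suc n ≤ x i
  left-large {i} (_ , i<n) = firstHalf-large i i<n

  right-small : ∀ {i} → Right (toℕ i) → x i ≤ n
  right-small {i} (n≤i , _) = secondHalf-small i n≤i

  σ-below-q : ∀ {i} → toℕ i < q → σ i ≡ i
  σ-below-q i<q = σ-outside (λ (q≤i , _) → <-irrefl refl (<-≤-trans i<q q≤i))
                             (λ (n≤i , _) → <-irrefl refl (<-≤-trans i<q (≤-trans (≤-trans q≤p (<⇒≤ p<n)) n≤i)))

  y-large-position : ∀ k → suc n ≤ y k → toℕ k < q ⊎ Right (toℕ k)
  y-large-position k n<yk with region (toℕ k)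
  ... | inLeft a = ⊥-elim (<-irrefl refl (<-≤-trans (s≤s (right-small (σ-left a))) n<yk))
  ... | inRight b = inj₂ b
  ... | outside ¬a ¬b with toℕ k <? n
  ...   | no k≮n = ⊥-elim (<-irrefl refl (<-≤-trans (s≤s (subst (_≤ n) (cong x (sym (σ-outside ¬a ¬b)))
                           (secondHalf-small k (≮⇒≥ k≮n)))) n<yk))
  ...   | yes k<n with toℕ k <? q
  ...     | yes k<q = inj₁ k<q
  ...     | no k≮q = ⊥-elim (¬a (≮⇒≥ k≮q , k<n))

  y-avoids : ¬ Has312* n y
  y-avoids (i , j , k , i<j , j<k , yj<yk , yk<yi , n<yk) with y-large-position k n<yk
  ... | inj₁ k<q rewrite σ-below-q k<q | σ-below-q (<-trans j<k k<q) | σ-below-q (<-trans i<j (<-trans j<k k<q)) =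
    x-avoids (i , j , k , i<j , j<k , yj<yk , yk<yi , n<yk)
  ... | inj₂ k-right with region (toℕ i)
  ...   | inLeft i-left = <-asym yk<yi (<-≤-trans (s≤s (right-small (σ-left i-left))) n<yk)
  ...   | outside ¬a ¬b = <-asym yk<yi
            (subst (_< y k) (cong x (sym (σ-outside ¬a ¬b)))
              (q-smallerPrefix i (σ k) i<q (proj₁ (σ-right k-right)) (proj₂ (σ-right k-right))))
    where
    i<q : toℕ i < q
    i<q = outside-below ¬a ¬b (<-trans i<j j<k) (proj₂ k-right)
  ...   | inRight i-right = x-avoids (σ i , σ j , σ k ,
            σ-monotone i<j (λ (a , _) → Left⇒¬Right a i-right) ,
            σ-monotone j<k (λ (a , _) → Left⇒¬Right a (≤-trans (proj₁ i-right) (<⇒≤ i<j) , <-trans j<k (proj₂ k-right))) ,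
            yj<yk , yk<yi , n<yk)

  y-tam : InTam n y
  y-tam = (y-perm , y-signed) , y-avoids

  Crossing : Fin N → Fin N → Set
  Crossing s t = Left (toℕ s) × Right (toℕ t)

  crossing? : ∀ s t → Dec (Crossing s t)
  crossing? s t = ((q ≤? toℕ s) ×-dec (toℕ s <? n)) ×-dec ((n ≤? toℕ t) ×-dec (toℕ t <? n + L))

  opposite-left : ∀ {i : Fin N} → Left (toℕ i) → Right (toℕ (opposite i))
  opposite-left {i} a = subst Right (sym (FP.opposite-prop i)) (Left⇒Right-reflect a)

  opposite-right : ∀ {i : Fin N} → Right (toℕ i) → Left (toℕ (opposite i))
  opposite-right {i} b = subst Left (sym (FP.opposite-prop i)) (Right⇒Left-reflect b)

  y-before⇒ : ∀ {u v} → Before n u v y → ∃ λ s → ∃ λ t → x s ≡ u × x t ≡ v × σ s F.< σ t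
  y-before⇒ (i , j , i<j , yi , yj) =
    σ i , σ j , yi , yj , subst₂ F._<_ (sym (σ-involutive i)) (sym (σ-involutive j)) i<j

  y-before : ∀ {s t} → σ s F.< σ t → Before n (x s) (x t) y
  y-before {s} {t} σs<σt = σ s , σ t , σs<σt , y-σ s , y-σ t

  y≤x : WeakLe n y x
  y≤x a b a<b ba with s , t , xs≡b , xt≡a , σs<σt ← y-before⇒ ba with FP.<-cmp s t
  ... | tri< s<t _ _ = s , t , s<t , xs≡b , xt≡a
  ... | tri≈ _ refl _ = ⊥-elim (FP.<-irrefl refl σs<σt)
  ... | tri> _ _ t<s with crossing? t s
  ...   | yes (t-left , s-right) =
          ⊥-elim (<-asym a<b (subst₂ _<_ xs≡b xt≡a (<-≤-trans (s≤s (right-small s-right)) (left-large t-left))))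
  ...   | no ¬crossing = ⊥-elim (FP.<-asym σs<σt (σ-monotone t<s ¬crossing))

  y-¬N-before-1 : ¬ Before n N 1 y
  y-¬N-before-1 N1 with s , t , xs≡N , xt≡1 , σs<σt ← y-before⇒ N1
                     with refl ← x-inj s p (trans xs≡N (sym xp≡N))
                        | refl ← x-inj t (opposite p) (trans xt≡1 (sym x-opposite-p≡1))
    = FP.<-asym σs<σt (σ-crossing p-left (opposite-left p-left))

  module Between (z : Word n) (z-tam : InTam n z) (y≤z : WeakLe n y z) (z≤x : WeakLe n z x) where

    z-perm : IsPerm n z
    z-perm = proj₁ (proj₁ z-tam)

    noncrossing-before : ∀ s t → s F.< t → ¬ Crossing s t → Before n (x s) (x t) z
    noncrossing-before s t s<t ¬crossing with <-cmp (x s) (x t)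
    ... | tri> _ _ xt<xs = y≤z (x t) (x s) xt<xs (y-before (σ-monotone s<t ¬crossing))
    ... | tri≈ _ xs≡xt _ = ⊥-elim (x-distinct s<t xs≡xt)
    ... | tri< xs<xt _ _ with before-total z-perm (x-range s) (x-range t) (x-distinct s<t)
    ...   | inj₁ st = st
    ...   | inj₂ ts = ⊥-elim (before-asym x-perm (s , t , s<t , refl , refl) (z≤x (x s) (x t) xs<xt ts))

    N-before-1⇒large-before-small : Before n N 1 z → ∀ {a b} → InRange a → a ≤ n → suc n ≤ b → b ≤ N →
                                    Before n b a z
    N-before-1⇒large-before-small N1 {a} {b} (1≤a , _) a≤n n<b b≤N = b-before-a
      where
      b-before-1 : Before n b 1 z
      b-before-1 with b ≟ N
      ... | yes refl = N1
      ... | no b≢N = inversion-through-large z-tam N1 (<-≤-trans (s≤s (s≤s z≤n)) (≤-trans (s≤s 1≤n) n<b))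
                       (≤∧≢⇒< b≤N b≢N) n<b
      b-before-a : Before n b a z
      b-before-a with a ≟ 1
      ... | yes refl = b-before-1
      ... | no a≢1 = inversion-through-small z-tam b-before-1 (≤∧≢⇒< 1≤a (a≢1 ∘ sym)) (<-≤-trans (s≤s a≤n) n<b) a≤n

    -- The inversion propagates through x r, the least entry of the left block, and its mirror x (opposite r),
    -- the greatest entry of the right block, and these sit between N and 1 in x.
    crossing⇒N-before-1 : ∀ {s t} → Crossing s t → Before n (x s) (x t) z → Before n N 1 z
    crossing⇒N-before-1 {s} {t} (s-left , t-right) st = propagated
      where
      xr-large : suc n ≤ x r
      xr-large = left-large r-left

      x-opposite-r≤n : x (opposite r) ≤ n
      x-opposite-r≤n = right-small (opposite-left r-left)

      xt<xr : x t < x r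
      xt<xr = <-≤-trans (s≤s (right-small t-right)) xr-large

      xr-before-xt : Before n (x r) (x t) z
      xr-before-xt with x s ≟ x r
      ... | yes xs≡xr = subst (λ u → Before n u (x t) z) xs≡xr st
      ... | no xs≢xr = inversion-through-large z-tam st xt<xr (≤∧≢⇒< (r-minimal s s-left) (xs≢xr ∘ sym)) xr-large

      xt≤mirror : x t ≤ x (opposite r)
      xt≤mirror = subst₂ _≤_ (mirror-involutive-inRange (x-range t)) (sym (x-opposite r))
                    (∸-monoʳ-≤ (suc N) (subst (x r ≤_) (x-opposite t) (r-minimal (opposite t) (opposite-right t-right))))

      xr-before-mirror : Before n (x r) (x (opposite r)) z
      xr-before-mirror with x t ≟ x (opposite r)
      ... | yes xt≡ = subst (λ u → Before n (x r) u z) xt≡ xr-before-xt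
      ... | no xt≢ = inversion-through-small z-tam xr-before-xt (≤∧≢⇒< xt≤mirror xt≢)
                       (<-≤-trans (s≤s x-opposite-r≤n) xr-large) x-opposite-r≤n

      propagated : Before n N 1 z
      propagated with p FP.≟ r
      ... | yes p≡r = subst₂ (λ u v → Before n u v z) (trans (cong x (sym p≡r)) xp≡N)
                        (trans (cong (x ∘ opposite) (sym p≡r)) x-opposite-p≡1) xr-before-mirror
      ... | no p≢r = before-trans z-perm N-before-xr (before-trans z-perm xr-before-mirror mirror-before-1)
        where
        p<r : p F.< r
        p<r = ≤∧≢⇒< p≤r (p≢r ∘ FP.toℕ-injective)
        N-before-xr : Before n N (x r) z
        N-before-xr = subst (λ u → Before n u (x r) z) xp≡N
                        (noncrossing-before p r p<r (λ (_ , r-right) → Left⇒¬Right r-left r-right))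
        mirror-before-1 : Before n (x (opposite r)) 1 z
        mirror-before-1 = subst (λ v → Before n (x (opposite r)) v z) x-opposite-p≡1
                            (noncrossing-before (opposite r) (opposite p) (opposite-reverse p<r)
                              (λ (or-left , _) → Left⇒¬Right or-left (opposite-left r-left)))

    z≡y⊎z≡x : WordEq n z y ⊎ WordEq n z x
    z≡y⊎z≡x with before? N 1 z
    ... | yes N1 = inj₂ (weakLe-antisym z-perm x-perm z≤x x≤z)
      where
      x≤z : WeakLe n x z
      x≤z a b a<b (s , t , s<t , refl , refl) with crossing? s t
      ... | yes (s-left , t-right) = N-before-1⇒large-before-small N1 (x-range t) (right-small t-right)
                                       (left-large s-left) (proj₂ (x-range s))
      ... | no ¬crossing = noncrossing-before s t s<t ¬crossing
    ... | no ¬N1 = inj₁ (weakLe-antisym z-perm y-perm z≤y y≤z)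
      where
      z≤y : WeakLe n z y
      z≤y a b a<b ba with s , t , s<t , refl , refl ← z≤x a b a<b ba with crossing? s t
      ... | yes crossing = ⊥-elim (¬N1 (crossing⇒N-before-1 crossing ba))
      ... | no ¬crossing = y-before (σ-monotone s<t ¬crossing)

  y-covered : CoveredInTam n y x
  y-covered = y-tam , y≤x , (λ y≡x → y-¬N-before-1 (before-resp (wordEq-sym y≡x) N-before-1)) ,
              λ z z-tam y≤z z≤x → Between.z≡y⊎z≡x z z-tam y≤z z≤x

module Pop (n : ℕ) (x : Word n) (x-tam : InTam n x) where
  open Permutations n
  open FiniteTam n

  open TamMeet n (x ∷ lowerCovers x) (x-tam ∷ All.tabulate (proj₁ ∘ lowerCovers-covered)) public

  meet-below-covers : ∀ y → CoveredInTam n y x → WeakLe n meet y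
  meet-below-covers y y⋖x with w , w∈ , w≡y ← covered⇒∈lowerCovers y⋖x = weakLe-respʳ w≡y (meet-lower (there w∈))

  meet-isPop : IsPopTam n x meet
  meet-isPop = meet-tam , meet-lower (here refl) , meet-below-covers ,
               λ z z-tam z≤x z≤covers → meet-greatest (proj₁ (proj₁ z-tam))
                                          (z≤x ∷ All.tabulate (λ w∈ → z≤covers _ (lowerCovers-covered w∈)))

  meet-¬N-before-1 : 1 ≤ n → ¬ Before n N 1 meet
  meet-¬N-before-1 1≤n with before? N 1 x
  ... | no x-¬N1 = ¬N-before-1-downward 1≤n (meet-lower (here refl)) x-¬N1
  ... | yes x-N1 = ¬N-before-1-downward 1≤n (meet-below-covers _ (SwapCover.y-covered n 1≤n x x-tam x-N1))
                     (SwapCover.y-¬N-before-1 n 1≤n x x-tam x-N1)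

mainTheorem10 : (n : ℕ) → 1 ≤ n → (x : Word n) → InTam n x →
    Σ (Word n) λ m → IsPopTam n x m × (∃[ i ] (m i ≡ n + n × n ≤ toℕ i))
mainTheorem10 n 1≤n x x-tam =
  meet , meet-isPop , Permutations.N-secondHalf n 1≤n (proj₁ meet-tam) (meet-¬N-before-1 1≤n)
  where open Pop n x x-tam
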